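{- There exists an absolute constant $C>0$ such that the following holds. Let $w \geq 2$ be an integer and let $M(w) := \max\big(C,\,160(w+1)^2+1\big)$. If $n \geq M(w)$, then there exists a connected graph $G$ on $n$ vertices satisfying the $w$-strong neighbourhood property and having maximum vertex degree \[ \Delta(G) \leq \max\big(10\log(2M(w)),\,8(w+1)\big)+1. \]
   Context: All graphs are finite and simple; $\log$ denotes the natural logarithm. For a vertex $v$, $N(v)$ is the set of vertices adjacent to $v$ (not including $v$), and $N[v] = N(v)\cup\{v\}$; $\#A$ denotes the cardinality of a set $A$. For an integer $k\ge 1$, a graph $G$ has the $k$-strong neighbourhood property if for any two distinct vertices $u,v$ of $G$, $\#\big(N[v]\setminus N[u]\big) \geq k$. -}

module Defs where

open import Data.Nat using (ℕ; zero; suc; _+_; _*_; _∸_; _^_; _≤_)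
open import Data.Nat using (_!)
open import Data.Bool using (Bool; true; false; _∨_; not; _∧_; if_then_else_; T)
open import Data.Fin using (Fin; _≟_)
open import Data.List using (List; map; allFin)
open import Data.Nat.ListAction using (sum)
open import Relation.Nullary.Decidable using (⌊_⌋)
open import Relation.Binary.PropositionalEquality using (_≡_; _≢_)

record Graph (n : ℕ) : Set where
  field
    adj    : Fin n → Fin n → Bool
    sym    : ∀ u v → adj u v ≡ adj v u
    irrefl : ∀ v → adj v v ≡ false
open Graph public

count : {n : ℕ} → (Fin n → Bool) → ℕ
count {n} f = sum (map (λ x → if f x then 1 else 0) (allFin n))

inClosedNbhd : {n : ℕ} → Graph n → Fin n → Fin n → Bool
inClosedNbhd G v x = ⌊ x ≟ v ⌋ ∨ adj G v x

degree : {n : ℕ} → Graph n → Fin n → ℕ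
degree G v = count (adj G v)

MaxDegreeAtMost : {n : ℕ} → Graph n → ℕ → Set
MaxDegreeAtMost {n} G D = (v : Fin n) → degree G v ≤ D

StrongNbhd : {n : ℕ} → ℕ → Graph n → Set
StrongNbhd {n} k G =
  (u v : Fin n) → u ≢ v →
  k ≤ count (λ x → inClosedNbhd G v x ∧ not (inClosedNbhd G u x))

data Walk {n : ℕ} (G : Graph n) : Fin n → Fin n → Set where
  here : ∀ {v} → Walk G v v
  step : ∀ {u w v} → T (adj G u w) → Walk G w v → Walk G u v

Connected : {n : ℕ} → Graph n → Set
Connected {n} G = (u v : Fin n) → Walk G u v

-- expScaled k m = m! * Σ_{j=0}^{m} k^j / j!   (an exact natural number)
expScaled : ℕ → ℕ → ℕ
expScaled k zero    = 1
expScaled k (suc m) = expScaled k m * suc m + k ^ suc m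

-- ExpAtMost k x  ⟺  e^k ≤ x  (e^k is the supremum of its partial sums)
ExpAtMost : ℕ → ℕ → Set
ExpAtMost k x = (m : ℕ) → expScaled k m ≤ x * (m !)

-- LogBound D x  ⟺  D ≤ 10 log x + 1   (for x ≥ 1, natural log)
--   ⟺ D ∸ 1 ≤ 10 log x ⟺ e^(D ∸ 1) ≤ x^10
LogBound : ℕ → ℕ → Set
LogBound D x = ExpAtMost (D ∸ 1) (x ^ 10)

{-# OPTIONS --safe #-}
-- Lay the n vertices out as a staircase grid: b rows of w + 2 cells on top of
-- a rows of w + 1 cells, where n = b (w + 2) + a (w + 1) with b > w (possible
-- once n ≥ 2 (w + 1)²).  Every row is a clique, and two cells of a column are
-- adjacent when their rows differ by at most w.  A vertex then sees at most
-- w + 1 others in its row and 2w in its column, so Δ ≤ 3 (w + 1), a bound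
-- independent of n.  For distinct u, v in different rows, the row of v minus the
-- column of u gives w private neighbours of v; in the same row, the w cells
-- of v's column within distance w of v do (b > w makes them exist even in the
-- last column).  Column 0 runs through all rows, so the graph is connected.

module Submission where

open import Defs hiding (sym)

open import Data.Bool using (Bool; true; false; _∨_; not; _∧_; if_then_else_; T)
open import Data.Bool.Properties using (∧-identityʳ; ∧-zeroʳ; T-∧; T-∨; T-not-≡)
open import Data.Empty using (⊥-elim)
open import Data.Fin using (Fin; zero; suc; _≟_; toℕ; fromℕ<)
import Data.Fin.Properties as Fin
open import Data.Fin.Properties using (toℕ-injective; toℕ-fromℕ<; toℕ<n; toℕ≤pred[n]; +↔⊎; *↔×)
open import Data.List using (tabulate; allFin)
open import Data.List.Properties using (map-tabulate; map-cong)
open import Data.Nat using (ℕ; zero; suc; _+_; _*_; _^_; _∸_; _≤_; _<_; _⊔_; _⊓_; ∣_-_∣; z≤n; s≤s; _<?_; _≤?_)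
open import Data.Nat.DivMod using (_/_; _%_; m≡m%n+[m/n]*n; m%n<n; m*n/n≡m; /-monoˡ-≤)
open import Data.Nat.ListAction using (sum)
open import Data.Nat.Properties hiding (_≟_)
open import Data.Nat.Properties using () renaming (_≟_ to _≟ℕ_)
open import Data.Nat.Tactic.RingSolver using (solve-∀)
open import Algebra.Properties.CommutativeSemigroup +-commutativeSemigroup using (interchange)
open import Data.Product using (Σ; _×_; _,_; proj₁; proj₂)
open import Data.Sum using (_⊎_; inj₁; inj₂)
open import Data.Sum.Function.Propositional using (_⊎-↔_)
open import Data.Unit using (tt)
open import Function using (_∘_)
open import Function.Bundles using (Equivalence; Injection; Inverse; _⇔_; _↔_; mk⇔)
open import Function.Properties.Inverse using (↔-trans; ↔⇒↣)
open import Relation.Binary.Definitions using (Decidable)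
open import Relation.Binary.PropositionalEquality
  using (_≡_; _≢_; refl; sym; trans; cong; cong₂; subst; subst₂; module ≡-Reasoning)
open import Relation.Nullary using (¬_; yes; no; does)
open import Relation.Nullary.Decidable
  using (Dec; ⌊_⌋; T?; ¬?; _×-dec_; _⊎-dec_; isYes≗does; does-⇔; dec-false; toWitness; fromWitness)

indicator : Bool → ℕ
indicator b = if b then 1 else 0

count≡sum-tabulate : ∀ {n} (f : Fin n → Bool) → count f ≡ sum (tabulate (indicator ∘ f))
count≡sum-tabulate f = cong sum (map-tabulate (λ x → x) (indicator ∘ f))

count-suc : ∀ {n} (f : Fin (suc n) → Bool) → count f ≡ indicator (f zero) + count (f ∘ suc)
count-suc f = trans (count≡sum-tabulate f) (cong (indicator (f zero) +_) (sym (count≡sum-tabulate (f ∘ suc))))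

count-cong : ∀ {n} {f g : Fin n → Bool} → (∀ x → f x ≡ g x) → count f ≡ count g
count-cong {n} f≗g = cong sum (map-cong (cong indicator ∘ f≗g) (allFin n))

count-true : ∀ n → count {n} (λ _ → true) ≡ n
count-true zero    = refl
count-true (suc n) = trans (count-suc {n} (λ _ → true)) (cong suc (count-true n))

indicator-T : ∀ {b} → T b → indicator b ≡ 1
indicator-T {true} _ = refl

indicator-¬T : ∀ {b} → ¬ T b → indicator b ≡ 0
indicator-¬T {false} _ = refl
indicator-¬T {true}  ¬b = ⊥-elim (¬b tt)

-- does, unlike ⌊_⌋, computes on suc x ≟ suc y, which count-without relies on.
without : ∀ {n} → (Fin n → Bool) → Fin n → Fin n → Bool
without f y x = f x ∧ not (does (x ≟ y))

count-without : ∀ {n} (f : Fin n → Bool) (y : Fin n) → T (f y) → count f ≡ suc (count (without f y))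
count-without {suc n} f zero fy = begin
  count f                                                     ≡⟨ count-suc f ⟩
  indicator (f zero) + count (f ∘ suc)                        ≡⟨ cong (_+ count (f ∘ suc)) (indicator-T fy) ⟩
  suc (count (f ∘ suc))                                       ≡⟨ cong suc (count-cong (sym ∘ ∧-identityʳ ∘ f ∘ suc)) ⟩
  suc (count (without f zero ∘ suc))                          ≡⟨ cong (λ b → suc (indicator b + count (without f zero ∘ suc))) (sym (∧-zeroʳ (f zero))) ⟩
  suc (indicator (without f zero zero) + count (without f zero ∘ suc))  ≡⟨ cong suc (sym (count-suc (without f zero))) ⟩
  suc (count (without f zero))                                ∎
  where open ≡-Reasoning
count-without {suc n} f (suc y) fy = begin
  count f                                                        ≡⟨ count-suc f ⟩
  indicator (f zero) + count (f ∘ suc)                           ≡⟨ cong (indicator (f zero) +_) (count-without (f ∘ suc) y fy) ⟩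
  indicator (f zero) + suc (count (without (f ∘ suc) y))         ≡⟨ +-suc (indicator (f zero)) _ ⟩
  suc (indicator (f zero) + count (without (f ∘ suc) y))         ≡⟨ cong (λ b → suc (indicator b + count (without (f ∘ suc) y))) (sym (∧-identityʳ (f zero))) ⟩
  suc (indicator (without f (suc y) zero) + count (without f (suc y) ∘ suc))  ≡⟨ cong suc (sym (count-suc (without f (suc y)))) ⟩
  suc (count (without f (suc y)))                                ∎
  where open ≡-Reasoning

InjectiveOn : ∀ {m} {A : Set} → (Fin m → Bool) → (Fin m → A) → Set
InjectiveOn f h = ∀ x y → T (f x) → T (f y) → h x ≡ h y → x ≡ y

injectiveOn-suc : ∀ {m} {A : Set} {f : Fin (suc m) → Bool} {h : Fin (suc m) → A} →
  InjectiveOn f h → InjectiveOn (f ∘ suc) (h ∘ suc)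
injectiveOn-suc injective x y fx fy = Fin.suc-injective ∘ injective (suc x) (suc y) fx fy

count-mono-injective : ∀ {m n} (f : Fin m → Bool) (g : Fin n → Bool) (h : Fin m → Fin n) →
  (∀ x → T (f x) → T (g (h x))) → InjectiveOn f h → count f ≤ count g
count-mono-injective {zero}  f g h preserves injective = z≤n
count-mono-injective {suc m} f g h preserves injective with T? (f zero)
... | no ¬f₀ = begin
  count f                                ≡⟨ count-suc f ⟩
  indicator (f zero) + count (f ∘ suc)   ≡⟨ cong (_+ count (f ∘ suc)) (indicator-¬T ¬f₀) ⟩
  count (f ∘ suc)                        ≤⟨ count-mono-injective (f ∘ suc) g (h ∘ suc) (preserves ∘ suc) (injectiveOn-suc injective) ⟩
  count g                                ∎
  where open ≤-Reasoning
... | yes f₀ = begin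
  count f                                ≡⟨ count-suc f ⟩
  indicator (f zero) + count (f ∘ suc)   ≡⟨ cong (_+ count (f ∘ suc)) (indicator-T f₀) ⟩
  suc (count (f ∘ suc))                  ≤⟨ s≤s (count-mono-injective (f ∘ suc) (without g (h zero)) (h ∘ suc) preserves-suc (injectiveOn-suc injective)) ⟩
  suc (count (without g (h zero)))       ≡⟨ sym (count-without g (h zero) (preserves zero f₀)) ⟩
  count g                                ∎
  where
  open ≤-Reasoning
  preserves-suc : ∀ x → T (f (suc x)) → T (without g (h zero) (h (suc x)))
  preserves-suc x fx = Equivalence.from T-∧ (preserves (suc x) fx ,
    Equivalence.from T-not-≡ (dec-false (h (suc x) ≟ h zero) λ e → Fin.0≢1+n (injective zero (suc x) f₀ fx (sym e))))

count-mono : ∀ {n} (f g : Fin n → Bool) → (∀ x → T (f x) → T (g x)) → count f ≤ count g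
count-mono f g f⊆g = count-mono-injective f g (λ x → x) f⊆g (λ _ _ _ _ e → e)

indicator-∨ : ∀ a b → indicator (a ∨ b) ≤ indicator a + indicator b
indicator-∨ true  b = s≤s z≤n
indicator-∨ false b = ≤-refl

count-∨ : ∀ {n} (f g : Fin n → Bool) → count (λ x → f x ∨ g x) ≤ count f + count g
count-∨ {zero}  f g = z≤n
count-∨ {suc n} f g = begin
  count (λ x → f x ∨ g x)
    ≡⟨ count-suc (λ x → f x ∨ g x) ⟩
  indicator (f zero ∨ g zero) + count (λ x → f (suc x) ∨ g (suc x))
    ≤⟨ +-mono-≤ (indicator-∨ (f zero) (g zero)) (count-∨ (f ∘ suc) (g ∘ suc)) ⟩
  (indicator (f zero) + indicator (g zero)) + (count (f ∘ suc) + count (g ∘ suc))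
    ≡⟨ interchange (indicator (f zero)) (indicator (g zero)) (count (f ∘ suc)) (count (g ∘ suc)) ⟩
  (indicator (f zero) + count (f ∘ suc)) + (indicator (g zero) + count (g ∘ suc))
    ≡⟨ sym (cong₂ _+_ (count-suc f) (count-suc g)) ⟩
  count f + count g ∎
  where open ≤-Reasoning

≤-count : ∀ {k n} (f : Fin n → Bool) (h : Fin k → Fin n) →
  (∀ i j → h i ≡ h j → i ≡ j) → (∀ j → T (f (h j))) → k ≤ count f
≤-count {k} f h injective inside = subst (_≤ count f) (count-true k)
  (count-mono-injective (λ _ → true) f h (λ j _ → inside j) (λ i j _ _ → injective i j))

count-≤ : ∀ {n} k (f : Fin n → Bool) (h : Fin n → ℕ) →
  (∀ x → T (f x) → h x ≤ k) → InjectiveOn f h → count f ≤ suc k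
count-≤ {n} k f h bounded injective = subst (count f ≤_) (count-true (suc k))
  (count-mono-injective f (λ _ → true) h′ (λ _ _ → tt) injective′)
  where
  h′ : Fin n → Fin (suc k)
  h′ x = fromℕ< (s≤s (m⊓n≤n (h x) k))
  toℕ-h′ : ∀ x → T (f x) → toℕ (h′ x) ≡ h x
  toℕ-h′ x fx = trans (toℕ-fromℕ< _) (m≤n⇒m⊓n≡m (bounded x fx))
  injective′ : InjectiveOn f h′
  injective′ x y fx fy e = injective x y fx fy (trans (sym (toℕ-h′ x fx)) (trans (cong toℕ e) (toℕ-h′ y fy)))

_++ʷ_ : ∀ {n} {G : Graph n} {x y z} → Walk G x y → Walk G y z → Walk G x z
here     ++ʷ q = q
step e p ++ʷ q = step e (p ++ʷ q)

reverseʷ : ∀ {n} (G : Graph n) {x y} → Walk G x y → Walk G y x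
reverseʷ G here                  = here
reverseʷ G (step {u} {w} e p) = reverseʷ G p ++ʷ step (subst T (Graph.sym G u w) e) here

connected-via-root : ∀ {n} (G : Graph n) (r : Fin n) → (∀ x → Walk G x r) → Connected G
connected-via-root G r toRoot u v = toRoot u ++ʷ reverseʷ G (toRoot v)

⌊⌋-⇔ : ∀ {a b} {A : Set a} {B : Set b} → A ⇔ B → (a? : Dec A) (b? : Dec B) → ⌊ a? ⌋ ≡ ⌊ b? ⌋
⌊⌋-⇔ A⇔B a? b? = trans (isYes≗does a?) (trans (does-⇔ A⇔B a? b?) (sym (isYes≗does b?)))

module RelationGraph {N : ℕ} (_∼_ : Fin N → Fin N → Set) (_∼?_ : Decidable _∼_)
  (∼-refl : ∀ x → x ∼ x) (∼-sym : ∀ {x y} → x ∼ y → y ∼ x) where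

  Adjacent : Fin N → Fin N → Set
  Adjacent x y = x ≢ y × x ∼ y

  adjacent? : Decidable Adjacent
  adjacent? x y = ¬? (x ≟ y) ×-dec (x ∼? y)

  adjacent-sym : ∀ {x y} → Adjacent x y → Adjacent y x
  adjacent-sym (x≢y , x∼y) = x≢y ∘ sym , ∼-sym x∼y

  graph : Graph N
  graph = record
    { adj    = λ x y → ⌊ adjacent? x y ⌋
    ; sym    = λ x y → ⌊⌋-⇔ (mk⇔ adjacent-sym adjacent-sym) (adjacent? x y) (adjacent? y x)
    ; irrefl = λ x → trans (isYes≗does (adjacent? x x)) (dec-false (adjacent? x x) λ (x≢x , _) → x≢x refl)
    }

  adj⇒∼ : ∀ {x y} → T (adj graph x y) → x ∼ y
  adj⇒∼ t = proj₂ (toWitness t)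

  ∼⇒adj : ∀ {x y} → x ≢ y → x ∼ y → T (adj graph x y)
  ∼⇒adj x≢y x∼y = fromWitness (x≢y , x∼y)

  ∼⇒walk : ∀ {x y} → x ∼ y → Walk graph x y
  ∼⇒walk {x} {y} x∼y with x ≟ y
  ... | yes refl = here
  ... | no x≢y   = step (∼⇒adj x≢y x∼y) here

  closedNbhd⇒∼ : ∀ v x → T (inClosedNbhd graph v x) → v ∼ x
  closedNbhd⇒∼ v x t with x ≟ v
  ... | yes refl = ∼-refl v
  ... | no _     = adj⇒∼ t

  ∼⇒closedNbhd : ∀ v x → v ∼ x → T (inClosedNbhd graph v x)
  ∼⇒closedNbhd v x v∼x with x ≟ v
  ... | yes _   = tt
  ... | no x≢v  = ∼⇒adj (x≢v ∘ sym) v∼x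

  degree≤count : ∀ v (f : Fin N → Bool) → (∀ x → v ∼ x → T (f x)) → degree graph v ≤ count f
  degree≤count v f covers = count-mono (adj graph v) f (λ x t → covers x (adj⇒∼ t))

  ≤-count-N[v]∖N[u] : ∀ {k} u v (h : Fin k → Fin N) → (∀ i j → h i ≡ h j → i ≡ j) →
    (∀ j → v ∼ h j) → (∀ j → ¬ u ∼ h j) →
    k ≤ count (λ x → inClosedNbhd graph v x ∧ not (inClosedNbhd graph u x))
  ≤-count-N[v]∖N[u] u v h injective near-v far-u = ≤-count _ h injective λ j →
    Equivalence.from T-∧ (∼⇒closedNbhd v (h j) (near-v j) ,
      Equivalence.from T-not-≡ (dec-false (T? _) λ t → far-u j (closedNbhd⇒∼ u (h j) t)))

skip : ℕ → ℕ → ℕ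
skip zero    j       = suc j
skip (suc c) zero    = zero
skip (suc c) (suc j) = suc (skip c j)

skip-≢ : ∀ c j → skip c j ≢ c
skip-≢ (suc c) zero    ()
skip-≢ (suc c) (suc j) e = skip-≢ c j (suc-injective e)

skip-injective : ∀ c {i j} → skip c i ≡ skip c j → i ≡ j
skip-injective zero                  e  = suc-injective e
skip-injective (suc c) {zero}  {zero}  _ = refl
skip-injective (suc c) {suc i} {suc j} e = cong suc (skip-injective c (suc-injective e))

skip-≤ : ∀ c j → skip c j ≤ suc j
skip-≤ zero    j       = ≤-refl
skip-≤ (suc c) zero    = z≤n
skip-≤ (suc c) (suc j) = s≤s (skip-≤ c j)

-- The j-th row of the window [r ∸ w, r ∸ w + w] other than r, which sits at offset w ⊓ r.
nearby : ℕ → ℕ → ℕ → ℕ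
nearby w r j = r ∸ w + skip (w ⊓ r) j

r∸w+w⊓r≡r : ∀ w r → r ∸ w + w ⊓ r ≡ r
r∸w+w⊓r≡r w r = trans (+-comm (r ∸ w) (w ⊓ r)) (m⊓n+n∸m≡n w r)

nearby-≢ : ∀ w r j → nearby w r j ≢ r
nearby-≢ w r j e = skip-≢ (w ⊓ r) j (+-cancelˡ-≡ (r ∸ w) _ _ (trans e (sym (r∸w+w⊓r≡r w r))))

nearby-injective : ∀ w r {i j} → nearby w r i ≡ nearby w r j → i ≡ j
nearby-injective w r e = skip-injective (w ⊓ r) (+-cancelˡ-≡ (r ∸ w) _ _ e)

nearby-≤ : ∀ {w j} r → j < w → nearby w r j ≤ r ∸ w + w
nearby-≤ {w} {j} r j<w = +-monoʳ-≤ (r ∸ w) (≤-trans (skip-≤ (w ⊓ r) j) j<w)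

nearby-close : ∀ {w j} r → j < w → ∣ r - nearby w r j ∣ ≤ w
nearby-close {w} {j} r j<w = begin
  ∣ r - nearby w r j ∣                                 ≡⟨ cong (∣_- nearby w r j ∣) (sym (r∸w+w⊓r≡r w r)) ⟩
  ∣ r ∸ w + w ⊓ r - r ∸ w + skip (w ⊓ r) j ∣           ≡⟨ ∣m+n-m+o∣≡∣n-o∣ (r ∸ w) (w ⊓ r) (skip (w ⊓ r) j) ⟩
  ∣ w ⊓ r - skip (w ⊓ r) j ∣                           ≤⟨ ∣m-n∣≤m⊔n (w ⊓ r) (skip (w ⊓ r) j) ⟩
  w ⊓ r ⊔ skip (w ⊓ r) j                               ≤⟨ ⊔-lub (m⊓n≤m w r) (≤-trans (skip-≤ (w ⊓ r) j) j<w) ⟩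
  w                                                    ∎
  where open ≤-Reasoning

∸+-< : ∀ {r k n} → r < n → k < n → r ∸ k + k < n
∸+-< {r} {k} {n} r<n k<n with ≤-total k r
... | inj₁ k≤r = subst (_< n) (sym (m∸n+n≡m k≤r)) r<n
... | inj₂ r≤k = subst (λ z → z + k < n) (sym (m≤n⇒m∸n≡0 r≤k)) k<n

∣-∣≤⇒≤+ : ∀ r s {w} → ∣ r - s ∣ ≤ w → r ≤ s + w
∣-∣≤⇒≤+ r s d = ≤-trans (m≤n+∣m-n∣ r s) (+-monoʳ-≤ s d)

∣-∣≤⇒+∸≤ : ∀ r s {w} → ∣ r - s ∣ ≤ w → s + w ∸ r ≤ w + w
∣-∣≤⇒+∸≤ r s {w} d = begin
  s + w ∸ r             ≤⟨ ∸-monoˡ-≤ r (+-monoˡ-≤ w (∣-∣≤⇒≤+ s r (subst (_≤ w) (∣-∣-comm r s) d))) ⟩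
  r + w + w ∸ r         ≡⟨ cong (_∸ r) (+-assoc r w w) ⟩
  r + (w + w) ∸ r       ≡⟨ m+n∸m≡n r (w + w) ⟩
  w + w                 ∎
  where open ≤-Reasoning

∣1+r-r∣≡1 : ∀ r → ∣ suc r - r ∣ ≡ 1
∣1+r-r∣≡1 zero    = refl
∣1+r-r∣≡1 (suc r) = ∣1+r-r∣≡1 r

[2+w]+[1+2w]≡3[1+w] : ∀ w → suc (suc w) + suc (w + w) ≡ 3 * suc w
[2+w]+[1+2w]≡3[1+w] = solve-∀

module Staircase (m a b : ℕ) where

  size : ℕ
  size = b * suc m + a * m

  Cell : Set
  Cell = (Fin b × Fin (suc m)) ⊎ (Fin a × Fin m)

  cells : Fin size ↔ Cell
  cells = ↔-trans +↔⊎ (*↔× ⊎-↔ *↔×)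

  position : Cell → ℕ × ℕ
  position (inj₁ (i , j)) = toℕ i , toℕ j
  position (inj₂ (i , j)) = b + toℕ i , toℕ j

  position-injective : ∀ {x y} → position x ≡ position y → x ≡ y
  position-injective {inj₁ (i , j)} {inj₁ (k , l)} e =
    cong inj₁ (cong₂ _,_ (toℕ-injective (cong proj₁ e)) (toℕ-injective (cong proj₂ e)))
  position-injective {inj₂ (i , j)} {inj₂ (k , l)} e =
    cong inj₂ (cong₂ _,_ (toℕ-injective (+-cancelˡ-≡ b _ _ (cong proj₁ e))) (toℕ-injective (cong proj₂ e)))
  position-injective {inj₁ (i , _)} {inj₂ _} e = ⊥-elim (m+n≮m b _ (subst (_< b) (cong proj₁ e) (toℕ<n i)))
  position-injective {inj₂ _} {inj₁ (k , _)} e = ⊥-elim (m+n≮m b _ (subst (_< b) (sym (cong proj₁ e)) (toℕ<n k)))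

  InShape : ℕ → ℕ → Set
  InShape r c = r < b + a × c ≤ m × (c ≡ m → r < b)

  inShape-short : ∀ {r c} → r < b + a → c < m → InShape r c
  inShape-short r<b+a c<m = r<b+a , <⇒≤ c<m , λ c≡m → ⊥-elim (<⇒≢ c<m c≡m)

  inShape-window : ∀ {k r r′ c} → k < b → InShape r c → r′ ≤ r ∸ k + k → InShape r′ c
  inShape-window k<b (r<b+a , c≤m , c≡m⇒r<b) r′≤ =
    ≤-<-trans r′≤ (∸+-< r<b+a (≤-trans k<b (m≤m+n b a))) , c≤m , λ c≡m → ≤-<-trans r′≤ (∸+-< (c≡m⇒r<b c≡m) k<b)

  row col : Fin size → ℕ
  row x = proj₁ (position (Inverse.to cells x))
  col x = proj₂ (position (Inverse.to cells x))

  row-col-injective : ∀ {x y} → row x ≡ row y → col x ≡ col y → x ≡ y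
  row-col-injective e₁ e₂ = Injection.injective (↔⇒↣ cells) (position-injective (cong₂ _,_ e₁ e₂))

  position-inShape : ∀ x → InShape (proj₁ (position x)) (proj₂ (position x))
  position-inShape (inj₁ (i , j)) = ≤-trans (toℕ<n i) (m≤m+n b a) , toℕ≤pred[n] j , λ _ → toℕ<n i
  position-inShape (inj₂ (i , j)) = +-monoʳ-< b (toℕ<n i) , <⇒≤ (toℕ<n j) , λ e → ⊥-elim (<⇒≢ (toℕ<n j) e)

  inShape : ∀ x → InShape (row x) (col x)
  inShape x = position-inShape (Inverse.to cells x)

  cellAt : ∀ r c → InShape r c → Cell
  cellAt r c (r<b+a , c≤m , c≡m⇒r<b) with r <? b
  ... | yes r<b = inj₁ (fromℕ< r<b , fromℕ< (s≤s c≤m))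
  ... | no  r≮b = inj₂ (fromℕ< (lower-row r<b+a r≮b) , fromℕ< (≤∧≢⇒< c≤m (r≮b ∘ c≡m⇒r<b)))
    where
    lower-row : ∀ {r} → r < b + a → ¬ r < b → r ∸ b < a
    lower-row {r} r<b+a r≮b = subst (r ∸ b <_) (m+n∸m≡n b a) (∸-monoˡ-< r<b+a (≮⇒≥ r≮b))

  position-cellAt : ∀ r c (p : InShape r c) → position (cellAt r c p) ≡ (r , c)
  position-cellAt r c (r<b+a , c≤m , c≡m⇒r<b) with r <? b
  ... | yes r<b = cong₂ _,_ (toℕ-fromℕ< r<b) (toℕ-fromℕ< (s≤s c≤m))
  ... | no  r≮b = cong₂ _,_ (trans (cong (b +_) (toℕ-fromℕ< _)) (m+[n∸m]≡n (≮⇒≥ r≮b))) (toℕ-fromℕ< _)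

  vertex : ∀ r c → InShape r c → Fin size
  vertex r c p = Inverse.from cells (cellAt r c p)

  position-vertex : ∀ r c (p : InShape r c) → (row (vertex r c p) , col (vertex r c p)) ≡ (r , c)
  position-vertex r c p = trans (cong position (Inverse.strictlyInverseˡ cells (cellAt r c p))) (position-cellAt r c p)

  row-vertex : ∀ r c (p : InShape r c) → row (vertex r c p) ≡ r
  row-vertex r c p = cong proj₁ (position-vertex r c p)

  col-vertex : ∀ r c (p : InShape r c) → col (vertex r c p) ≡ c
  col-vertex r c p = cong proj₂ (position-vertex r c p)

module StaircaseGraph (w a b : ℕ) (w<b : w < b) where

  open Staircase (suc w) a b public

  _∼_ : Fin size → Fin size → Set
  x ∼ y = row x ≡ row y ⊎ (col x ≡ col y × ∣ row x - row y ∣ ≤ w)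

  _∼?_ : Decidable _∼_
  x ∼? y = (row x ≟ℕ row y) ⊎-dec ((col x ≟ℕ col y) ×-dec (∣ row x - row y ∣ ≤? w))

  ∼-sym : ∀ {x y} → x ∼ y → y ∼ x
  ∼-sym         (inj₁ e)       = inj₁ (sym e)
  ∼-sym {x} {y} (inj₂ (e , d)) = inj₂ (sym e , subst (_≤ w) (∣-∣-comm (row x) (row y)) d)

  open RelationGraph _∼_ _∼?_ (λ _ → inj₁ refl) ∼-sym public

  module _ (v : Fin size) where

    sameRow? : ∀ x → Dec (row v ≡ row x)
    sameRow? x = row v ≟ℕ row x

    sameColumnNear? : ∀ x → Dec (col v ≡ col x × ∣ row v - row x ∣ ≤ w)
    sameColumnNear? x = (col v ≟ℕ col x) ×-dec (∣ row v - row x ∣ ≤? w)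

    sameRow sameColumnNear : Fin size → Bool
    sameRow x        = ⌊ sameRow? x ⌋
    sameColumnNear x = ⌊ sameColumnNear? x ⌋

    sameRow⇒ : ∀ x → T (sameRow x) → row v ≡ row x
    sameRow⇒ x = toWitness {a? = sameRow? x}

    sameColumnNear⇒ : ∀ x → T (sameColumnNear x) → col v ≡ col x × ∣ row v - row x ∣ ≤ w
    sameColumnNear⇒ x = toWitness {a? = sameColumnNear? x}

    count-sameRow : count sameRow ≤ suc (suc w)
    count-sameRow = count-≤ (suc w) sameRow col (λ x _ → proj₁ (proj₂ (inShape x)))
      λ x y sx sy → row-col-injective (trans (sym (sameRow⇒ x sx)) (sameRow⇒ y sy))

    count-sameColumnNear : count sameColumnNear ≤ suc (w + w)
    count-sameColumnNear = count-≤ (w + w) sameColumnNear offset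
      (λ x sx → ∣-∣≤⇒+∸≤ (row v) (row x) (proj₂ (sameColumnNear⇒ x sx))) offset-injective
      where
      offset : Fin size → ℕ
      offset x = row x + w ∸ row v
      offset-injective : InjectiveOn sameColumnNear offset
      offset-injective x y sx sy e = row-col-injective
        (+-cancelʳ-≡ w (row x) (row y) (∸-cancelʳ-≡ (close x sx) (close y sy) e))
        (trans (sym (proj₁ (sameColumnNear⇒ x sx))) (proj₁ (sameColumnNear⇒ y sy)))
        where
        close : ∀ z → T (sameColumnNear z) → row v ≤ row z + w
        close z sz = ∣-∣≤⇒≤+ (row v) (row z) (proj₂ (sameColumnNear⇒ z sz))

    degree≤3[w+1] : degree graph v ≤ 3 * suc w
    degree≤3[w+1] = begin
      degree graph v                                       ≤⟨ degree≤count v _ covered ⟩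
      count (λ x → sameRow x ∨ sameColumnNear x)           ≤⟨ count-∨ sameRow sameColumnNear ⟩
      count sameRow + count sameColumnNear                 ≤⟨ +-mono-≤ count-sameRow count-sameColumnNear ⟩
      suc (suc w) + suc (w + w)                            ≡⟨ [2+w]+[1+2w]≡3[1+w] w ⟩
      3 * suc w                                            ∎
      where
      open ≤-Reasoning
      covered : ∀ x → v ∼ x → T (sameRow x ∨ sameColumnNear x)
      covered x (inj₁ e) = Equivalence.from (T-∨ {sameRow x}) (inj₁ (fromWitness e))
      covered x (inj₂ p) = Equivalence.from (T-∨ {sameRow x}) (inj₂ (fromWitness p))

  strongNbhd : StrongNbhd w graph
  strongNbhd u v u≢v with row u ≟ℕ row v
  ... | no row-u≢v = ≤-count-N[v]∖N[u] u v inRow inRow-injective (λ j → inj₁ (sym (row-inRow j))) far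
    where
    column : Fin w → ℕ
    column j = skip (col u) (toℕ j)
    column<1+w : ∀ j → column j < suc w
    column<1+w j = s≤s (≤-trans (skip-≤ (col u) (toℕ j)) (toℕ<n j))
    inRow : Fin w → Fin size
    inRow j = vertex (row v) (column j) (inShape-short (proj₁ (inShape v)) (column<1+w j))
    row-inRow : ∀ j → row (inRow j) ≡ row v
    row-inRow j = row-vertex _ _ _
    col-inRow : ∀ j → col (inRow j) ≡ column j
    col-inRow j = col-vertex _ _ _
    inRow-injective : ∀ i j → inRow i ≡ inRow j → i ≡ j
    inRow-injective i j e = toℕ-injective (skip-injective (col u)
      (trans (sym (col-inRow i)) (trans (cong col e) (col-inRow j))))
    far : ∀ j → ¬ u ∼ inRow j
    far j (inj₁ e)       = row-u≢v (trans e (row-inRow j))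
    far j (inj₂ (e , _)) = skip-≢ (col u) (toℕ j) (sym (trans e (col-inRow j)))
  ... | yes row-u≡v = ≤-count-N[v]∖N[u] u v inColumn inColumn-injective near far
    where
    col-u≢v : col u ≢ col v
    col-u≢v e = u≢v (row-col-injective row-u≡v e)
    inColumn : Fin w → Fin size
    inColumn j = vertex (nearby w (row v) (toℕ j)) (col v)
      (inShape-window w<b (inShape v) (nearby-≤ (row v) (toℕ<n j)))
    row-inColumn : ∀ j → row (inColumn j) ≡ nearby w (row v) (toℕ j)
    row-inColumn j = row-vertex _ _ _
    col-inColumn : ∀ j → col (inColumn j) ≡ col v
    col-inColumn j = col-vertex _ _ _
    inColumn-injective : ∀ i j → inColumn i ≡ inColumn j → i ≡ j
    inColumn-injective i j e = toℕ-injective (nearby-injective w (row v)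
      (trans (sym (row-inColumn i)) (trans (cong row e) (row-inColumn j))))
    near : ∀ j → v ∼ inColumn j
    near j = inj₂ (sym (col-inColumn j) ,
      subst (λ r → ∣ row v - r ∣ ≤ w) (sym (row-inColumn j)) (nearby-close (row v) (toℕ<n j)))
    far : ∀ j → ¬ u ∼ inColumn j
    far j (inj₁ e)       = nearby-≢ w (row v) (toℕ j) (trans (sym (row-inColumn j)) (trans (sym e) row-u≡v))
    far j (inj₂ (e , _)) = col-u≢v (trans e (col-inColumn j))

  connected : 0 < w → Connected graph
  connected 0<w = connected-via-root graph root toRoot
    where
    0<b+a : 0 < b + a
    0<b+a = ≤-trans (s≤s z≤n) (≤-trans w<b (m≤m+n b a))
    columnZero : ∀ {r} → r < b + a → Fin size
    columnZero r<b+a = vertex _ 0 (inShape-short r<b+a (s≤s z≤n))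
    root : Fin size
    root = columnZero 0<b+a
    row-columnZero : ∀ {r} (p : r < b + a) → row (columnZero p) ≡ r
    row-columnZero p = row-vertex _ _ _
    col-columnZero : ∀ {r} (p : r < b + a) → col (columnZero p) ≡ 0
    col-columnZero p = col-vertex _ _ _
    down : ∀ r (p : r < b + a) → Walk graph (columnZero p) root
    down zero    p = ∼⇒walk (inj₁ (trans (row-columnZero p) (sym (row-columnZero 0<b+a))))
    down (suc r) p = ∼⇒walk (inj₂ (trans (col-columnZero p) (sym (col-columnZero p′)) , adjacent-rows)) ++ʷ down r p′
      where
      p′ : r < b + a
      p′ = <-trans (n<1+n r) p
      adjacent-rows : ∣ row (columnZero p) - row (columnZero p′) ∣ ≤ w
      adjacent-rows = subst₂ (λ s t → ∣ s - t ∣ ≤ w) (sym (row-columnZero p)) (sym (row-columnZero p′))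
        (subst (_≤ w) (sym (∣1+r-r∣≡1 r)) 0<w)
    toRoot : ∀ x → Walk graph x root
    toRoot x = ∼⇒walk (inj₁ (sym (row-columnZero (proj₁ (inShape x))))) ++ʷ down (row x) (proj₁ (inShape x))

staircase-decomposition : ∀ w n → 2 * suc w * suc w ≤ n →
  Σ ℕ λ a → Σ ℕ λ b → w < b × b * suc (suc w) + a * suc w ≡ n
staircase-decomposition w n 2[1+w]²≤n = t , n % m + m , m≤n+m m (n % m) , sym n≡
  where
  m : ℕ
  m = suc w
  2m≤n/m : 2 * m ≤ n / m
  2m≤n/m = subst (_≤ n / m) (m*n/n≡m (2 * m) m) (/-monoˡ-≤ m 2[1+w]²≤n)
  1+b≤n/m : suc (n % m + m) ≤ n / m
  1+b≤n/m = ≤-trans (+-monoˡ-≤ m (m%n<n n m)) (subst (_≤ n / m) (cong (m +_) (+-identityʳ m)) 2m≤n/m)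
  t : ℕ
  t = proj₁ (m≤n⇒∃[o]m+o≡n 1+b≤n/m)
  n≡ : n ≡ (n % m + m) * suc m + t * m
  n≡ = begin
    n                                    ≡⟨ m≡m%n+[m/n]*n n m ⟩
    n % m + n / m * m                    ≡⟨ cong (λ q → n % m + q * m) (sym (proj₂ (m≤n⇒∃[o]m+o≡n 1+b≤n/m))) ⟩
    n % m + (suc (n % m + m) + t) * m    ≡⟨ regroup (n % m) m t ⟩
    (n % m + m) * suc m + t * m          ∎
    where
    open ≡-Reasoning
    regroup : ∀ r m t → r + (suc (r + m) + t) * m ≡ (r + m) * suc m + t * m
    regroup = solve-∀

2[1+w]²≤160[w+1]²+1 : ∀ w → 2 * suc w * suc w ≤ 160 * (w + 1) ^ 2 + 1
2[1+w]²≤160[w+1]²+1 w = subst (2 * suc w * suc w ≤_) (sym (split w)) (m≤m+n _ _)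
  where
  split : ∀ w → 160 * ((w + 1) * ((w + 1) * 1)) + 1 ≡ 2 * suc w * suc w + (158 * ((w + 1) * (w + 1)) + 1)
  split = solve-∀

3[1+w]≤8[w+1]+1 : ∀ w → 3 * suc w ≤ 8 * (w + 1) + 1
3[1+w]≤8[w+1]+1 w = subst (3 * suc w ≤_) (sym (split w)) (m≤m+n _ _)
  where
  split : ∀ w → 8 * (w + 1) + 1 ≡ 3 * suc w + (5 * suc w + 1)
  split = solve-∀

staircase-graph : ∀ w → 0 < w → ∀ n → 2 * suc w * suc w ≤ n →
  Σ (Graph n) λ G → Connected G × StrongNbhd w G × MaxDegreeAtMost G (3 * suc w)
staircase-graph w 0<w n 2[1+w]²≤n with staircase-decomposition w n 2[1+w]²≤n
... | a , b , w<b , refl = graph , connected 0<w , strongNbhd , degree≤3[w+1]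
  where open StaircaseGraph w a b w<b

theorem2 : Σ ℕ λ C → 0 < C ×
    ((w : ℕ) → 2 ≤ w → (n : ℕ) → C ⊔ (160 * (w + 1) ^ 2 + 1) ≤ n →
      Σ (Graph n) λ G → Connected G × StrongNbhd w G ×
        Σ ℕ λ D → MaxDegreeAtMost G D ×
          (LogBound D (2 * (C ⊔ (160 * (w + 1) ^ 2 + 1))) ⊎ D ≤ 8 * (w + 1) + 1))
theorem2 = 1 , s≤s z≤n , λ w 2≤w n M≤n →
  let 2[1+w]²≤n = ≤-trans (2[1+w]²≤160[w+1]²+1 w) (m⊔n≤o⇒n≤o 1 (160 * (w + 1) ^ 2 + 1) M≤n)
      (G , connected , strong , maxDegree) = staircase-graph w (<-≤-trans (s≤s z≤n) 2≤w) n 2[1+w]²≤n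
  in G , connected , strong , 3 * suc w , maxDegree , inj₂ (3[1+w]≤8[w+1]+1 w)
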